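{- Let $G=(V,E)$ be a graph on $n$ vertices with minimum degree at least $\epsilon n$, where $\epsilon>0$. Then there is a covering $E=E_1\cup\cdots\cup E_\ell$ of the edge set of $G$ (not necessarily disjoint) with $\ell=2\epsilon^{ -2}\log_2 n$ such that for $1\le i\le \ell$ the diameter of $E_i$ is at most $3$.
   Context: The diameter of a connected graph is the maximum distance between two vertices ($\infty$ if disconnected). The diameter of an edge set $E'$ is the diameter of the graph with edge set $E'$ on the vertices covered by $E'$. -}

module Defs where

open import Data.Nat using (ℕ; zero; suc; _≤_)
open import Data.Fin using (Fin)
open import Data.Bool using (Bool; true; false; T)
open import Data.Bool.Properties using (T?)
open import Data.List using (List; length; filter; allFin)
open import Data.Product using (Σ; ∃; ∃-syntax; _×_)
open import Relation.Binary.PropositionalEquality using (_≡_)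

record Graph (n : ℕ) : Set where
  field
    adj    : Fin n → Fin n → Bool
    sym    : ∀ u v → adj u v ≡ adj v u
    irrefl : ∀ v → adj v v ≡ false
open Graph public

degree : ∀ {n} → Graph n → Fin n → ℕ
degree {n} G v = length (filter (λ w → T? (adj G v w)) (allFin n))

record EdgeSubset {n : ℕ} (G : Graph n) : Set where
  field
    mem    : Fin n → Fin n → Bool
    memSym : ∀ u v → mem u v ≡ mem v u
    memSub : ∀ u v → mem u v ≡ true → adj G u v ≡ true
open EdgeSubset public

data Walk {n : ℕ} {G : Graph n} (H : EdgeSubset G) : ℕ → Fin n → Fin n → Set where
  here : ∀ {v} → Walk H zero v v
  step : ∀ {k u w v} → mem H u w ≡ true → Walk H k w v → Walk H (suc k) u v

Covered : ∀ {n} {G : Graph n} → EdgeSubset G → Fin n → Set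
Covered {n} H v = ∃[ w ] mem H v w ≡ true

DistLe : ∀ {n} {G : Graph n} → EdgeSubset G → Fin n → Fin n → ℕ → Set
DistLe H u v d = ∃[ k ] (k ≤ d × Walk H k u v)

-- diameter of the edge set H is at most d: any two vertices covered by H
-- are joined by a walk in H of length ≤ d (this also forces connectivity)
DiamLe : ∀ {n} {G : Graph n} → EdgeSubset G → ℕ → Set
DiamLe H d = ∀ u v → Covered H u → Covered H v → DistLe H u v d

-- For vertices x and y let B(x, y) consist of the edges between N(x) and N(y), the edges from x
-- to its neighbours that have a neighbour in N(y), and those from y to its neighbours that have
-- a neighbour in N(x). Any two vertices covered by B(x, y) are joined in it by a path of length
-- at most 3, running through x, y and one edge between N(x) and N(y).
-- Orient every edge and choose pairs greedily. For a set U of oriented edges,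
-- ∑_{x,y} |U ∩ N(x) × N(y)| = ∑_{(u,w) ∈ U} deg u deg w ≥ ε² n² |U|, so some N(x) × N(y)
-- contains a fraction ε² of U. After ℓ rounds at most (1 - ε²)^ℓ n²/2 oriented edges are left,
-- and since (1 - ε²)^(1/ε²) ≤ 1/2 this is below 1 for the largest ℓ with 2^(ℓ ε²) ≤ n².

module Submission where

open import Defs hiding (sym)
open import Data.Nat
open import Data.Nat.Properties
open import Data.Nat.Tactic.RingSolver using (solve-∀)
open import Data.Fin using (Fin; zero; suc; toℕ; fromℕ; inject₁) renaming (_<?_ to _<ᶠ?_)
open import Data.Fin.Properties using (any?; toℕ-fromℕ; toℕ-inject₁)
  renaming (_≟_ to _≟ᶠ_; <-cmp to <ᶠ-cmp; <-asym to <ᶠ-asym)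
open import Data.Bool using (Bool; true; false; _∧_; not; T)
open import Data.Bool.Properties using (T?) renaming (_≟_ to _≟ᵇ_)
open import Data.List using (length; filter; tabulate; allFin)
open import Data.List.Properties using (filter-notAll; length-tabulate)
open import Data.List.Membership.Propositional using (lose)
open import Data.List.Membership.Propositional.Properties using (∈-allFin)
open import Data.Product using (Σ; ∃; ∃-syntax; _×_; _,_; proj₁; proj₂; uncurry)
open import Data.Sum using (_⊎_; inj₁; inj₂; swap; [_,_]′)
open import Data.Empty using (⊥-elim)
open import Function using (mk⇔)
open import Relation.Binary.PropositionalEquality
open import Relation.Binary.Definitions using (tri<; tri≈; tri>)
open import Relation.Nullary using (¬_; Dec; does; yes; no; _×-dec_; _⊎-dec_)
open import Relation.Nullary.Decidable using (dec-true; dec-false; does-⇔)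
open import Relation.Unary using (Pred; Decidable)
open import Algebra.Properties.Semiring.Sum +-*-semiring
  using (sum; sum-syntax; ∑-comm; ∑-distrib-+; *-distribˡ-sum; *-distribʳ-sum; sum-cong-≗)
open import Algebra.Properties.CommutativeSemigroup *-commutativeSemigroup
  using (interchange; x∙yz≈y∙xz; xy∙z≈y∙xz)

-- Elementary estimates

-- (1 + 1/s)^a ≥ 1 + a/s, cleared of denominators.
bernoulli : ∀ s a → s ^ a * (s + a) ≤ s * suc s ^ a
bernoulli s zero = ≤-reflexive (base s)
  where
  base : ∀ s → 1 * (s + 0) ≡ s * 1
  base = solve-∀
bernoulli s (suc a) = begin
  s * s ^ a * (s + suc a)               ≡⟨ expand s (s ^ a) a ⟩
  s * (s ^ a * (s + a)) + s ^ a * s     ≤⟨ +-monoʳ-≤ (s * (s ^ a * (s + a))) (*-monoʳ-≤ (s ^ a) (m≤m+n s a)) ⟩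
  s * (s ^ a * (s + a)) + s ^ a * (s + a) ≡⟨ +-comm (s * (s ^ a * (s + a))) _ ⟩
  suc s * (s ^ a * (s + a))             ≤⟨ *-monoʳ-≤ (suc s) (bernoulli s a) ⟩
  suc s * (s * suc s ^ a)               ≡⟨ regroup s (suc s ^ a) ⟩
  s * (suc s * suc s ^ a)               ∎
  where
  open ≤-Reasoning
  expand : ∀ s X a → s * X * (s + suc a) ≡ s * (X * (s + a)) + X * s
  expand = solve-∀
  regroup : ∀ s Y → suc s * (s * Y) ≡ s * (suc s * Y)
  regroup = solve-∀

2*s^a≤[1+s]^a : ∀ {s a} → s < a → 2 * s ^ a ≤ suc s ^ a
2*s^a≤[1+s]^a {zero}  {suc a} _   = z≤n
2*s^a≤[1+s]^a {suc s} {a}     s<a = *-cancelʳ-≤ _ _ (suc s) (begin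
  2 * suc s ^ a * suc s           ≡⟨ double (suc s ^ a) (suc s) ⟩
  suc s ^ a * (suc s + suc s)     ≤⟨ *-monoʳ-≤ (suc s ^ a) (+-monoʳ-≤ (suc s) (<⇒≤ s<a)) ⟩
  suc s ^ a * (suc s + a)         ≤⟨ bernoulli (suc s) a ⟩
  suc s * suc (suc s) ^ a         ≡⟨ *-comm (suc s) _ ⟩
  suc (suc s) ^ a * suc s         ∎)
  where
  open ≤-Reasoning
  double : ∀ X t → 2 * X * t ≡ X * (t + t)
  double = solve-∀

-- (1 - d/a)^a ≤ 2^-d, in the form b^a 2^d ≤ (b + d)^a.
b^a*2^d≤[b+d]^a : ∀ b d {a} → b + d ≤ a → b ^ a * 2 ^ d ≤ (b + d) ^ a
b^a*2^d≤[b+d]^a b zero {a} _ rewrite *-identityʳ (b ^ a) | +-identityʳ b = ≤-refl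
b^a*2^d≤[b+d]^a b (suc d) {a} b+1+d≤a = begin
  b ^ a * (2 * 2 ^ d)     ≡⟨ rearrange (b ^ a) (2 ^ d) ⟩
  2 * b ^ a * 2 ^ d       ≤⟨ *-monoˡ-≤ (2 ^ d) (2*s^a≤[1+s]^a (<-≤-trans (m<m+n b z<s) b+1+d≤a)) ⟩
  suc b ^ a * 2 ^ d       ≤⟨ b^a*2^d≤[b+d]^a (suc b) d (≤-trans (≤-reflexive (sym (+-suc b d))) b+1+d≤a) ⟩
  (suc b + d) ^ a         ≡⟨ cong (_^ a) (sym (+-suc b d)) ⟩
  (b + suc d) ^ a         ∎
  where
  open ≤-Reasoning
  rearrange : ∀ X Y → X * (2 * Y) ≡ 2 * X * Y
  rearrange = solve-∀

^-distribʳ-* : ∀ m n o → (m * n) ^ o ≡ m ^ o * n ^ o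
^-distribʳ-* m n zero    = refl
^-distribʳ-* m n (suc o) = begin
  m * n * (m * n) ^ o       ≡⟨ cong (m * n *_) (^-distribʳ-* m n o) ⟩
  m * n * (m ^ o * n ^ o)   ≡⟨ interchange m n (m ^ o) (n ^ o) ⟩
  m * m ^ o * (n * n ^ o)   ∎
  where open ≡-Reasoning

[m^n]^o≡[m^o]^n : ∀ m n o → (m ^ n) ^ o ≡ (m ^ o) ^ n
[m^n]^o≡[m^o]^n m n o = begin
  (m ^ n) ^ o ≡⟨ ^-*-assoc m n o ⟩
  m ^ (n * o) ≡⟨ cong (m ^_) (*-comm n o) ⟩
  m ^ (o * n) ≡⟨ ^-*-assoc m o n ⟨
  (m ^ o) ^ n ∎
  where open ≡-Reasoning

[b^k]^a*2^[[1+k]*d]≤2^a*[a^k]^a : ∀ b d k → let a = b + d in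
                                  (b ^ k) ^ a * 2 ^ (suc k * d) ≤ 2 ^ a * (a ^ k) ^ a
[b^k]^a*2^[[1+k]*d]≤2^a*[a^k]^a b d k = begin
  (b ^ k) ^ a * 2 ^ (d + k * d)        ≡⟨ cong₂ _*_ ([m^n]^o≡[m^o]^n b k a) (^-distribˡ-+-* 2 d (k * d)) ⟩
  (b ^ a) ^ k * (2 ^ d * 2 ^ (k * d))  ≡⟨ cong (λ e → (b ^ a) ^ k * (2 ^ d * 2 ^ e)) (*-comm k d) ⟩
  (b ^ a) ^ k * (2 ^ d * 2 ^ (d * k))  ≡⟨ cong (λ c → (b ^ a) ^ k * (2 ^ d * c)) (^-*-assoc 2 d k) ⟨
  (b ^ a) ^ k * (2 ^ d * (2 ^ d) ^ k)  ≡⟨ x∙yz≈y∙xz ((b ^ a) ^ k) (2 ^ d) ((2 ^ d) ^ k) ⟩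
  2 ^ d * ((b ^ a) ^ k * (2 ^ d) ^ k)  ≡⟨ cong (2 ^ d *_) (^-distribʳ-* (b ^ a) (2 ^ d) k) ⟨
  2 ^ d * (b ^ a * 2 ^ d) ^ k          ≤⟨ *-mono-≤ (^-monoʳ-≤ 2 (m≤n+m d b)) (^-monoˡ-≤ k (b^a*2^d≤[b+d]^a b d ≤-refl)) ⟩
  2 ^ a * (a ^ a) ^ k                  ≡⟨ cong (2 ^ a *_) ([m^n]^o≡[m^o]^n a a k) ⟩
  2 ^ a * (a ^ k) ^ a                  ∎
  where
  open ≤-Reasoning
  a = b + d

-- If each of k rounds keeps at most a fraction 1 - d/a of M ≤ T/2 items, fewer than one
-- item is left once T^a < 2^((k+1)d): raise both sides to the a-th power.
[a∸d]^k*M<a^k : ∀ {a d k M T} → d < a → 2 * M ≤ T → T ^ a < 2 ^ (suc k * d) → (a ∸ d) ^ k * M < a ^ k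
[a∸d]^k*M<a^k {a} {d} {k} {M} {T} d<a 2M≤T T^a<2^[[1+k]*d] =
  ≰⇒> λ a^k≤X → <⇒≱ (*-cancelˡ-< (2 ^ a) _ _ 2^a*X^a<2^a*[a^k]^a) (^-monoˡ-≤ a a^k≤X)
  where
  b = a ∸ d
  X = b ^ k * M
  instance
    [b^k]^a≢0 : NonZero ((b ^ k) ^ a)
    [b^k]^a≢0 = m^n≢0 (b ^ k) a {{m^n≢0 b k {{>-nonZero (m<n⇒0<n∸m d<a)}}}}
  2^a*X^a<2^a*[a^k]^a : 2 ^ a * X ^ a < 2 ^ a * (a ^ k) ^ a
  2^a*X^a<2^a*[a^k]^a = begin-strict
    2 ^ a * X ^ a                      ≡⟨ ^-distribʳ-* 2 X a ⟨
    (2 * (b ^ k * M)) ^ a              ≡⟨ cong (_^ a) (x∙yz≈y∙xz 2 (b ^ k) M) ⟩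
    (b ^ k * (2 * M)) ^ a              ≤⟨ ^-monoˡ-≤ a (*-monoʳ-≤ (b ^ k) 2M≤T) ⟩
    (b ^ k * T) ^ a                    ≡⟨ ^-distribʳ-* (b ^ k) T a ⟩
    (b ^ k) ^ a * T ^ a                <⟨ *-monoʳ-< ((b ^ k) ^ a) T^a<2^[[1+k]*d] ⟩
    (b ^ k) ^ a * 2 ^ (suc k * d)      ≤⟨ subst (λ a → (b ^ k) ^ a * 2 ^ (suc k * d) ≤ 2 ^ a * (a ^ k) ^ a)
                                            (m∸n+n≡m (<⇒≤ d<a)) ([b^k]^a*2^[[1+k]*d]≤2^a*[a^k]^a b d k) ⟩
    2 ^ a * (a ^ k) ^ a                ∎
    where open ≤-Reasoning

∃-threshold : ∀ {ℓ} {P : ℕ → Set ℓ} → Decidable P → P 0 → ∀ K → ¬ P K → ∃[ k ] (P k × ¬ P (suc k))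
∃-threshold P? P0 zero    ¬P0 = ⊥-elim (¬P0 P0)
∃-threshold P? P0 (suc K) ¬PK with P? K
... | yes PK  = K , PK , ¬PK
... | no  ¬PK′ = ∃-threshold P? P0 K ¬PK′

n<2^n : ∀ n → n < 2 ^ n
n<2^n zero    = z<s
n<2^n (suc n) = begin-strict
  suc n           ≤⟨ n<2^n n ⟩
  2 ^ n           <⟨ m<m+n (2 ^ n) (m^n>0 2 n) ⟩
  2 ^ n + 2 ^ n   ≡⟨ cong (2 ^ n +_) (+-identityʳ (2 ^ n)) ⟨
  2 ^ suc n       ∎
  where open ≤-Reasoning

[n*n]^m≡n^[2*m] : ∀ n m → (n * n) ^ m ≡ n ^ (2 * m)
[n*n]^m≡n^[2*m] n m = begin
  (n * n) ^ m       ≡⟨ ^-distribʳ-* n n m ⟩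
  n ^ m * n ^ m     ≡⟨ ^-distribˡ-+-* n m m ⟨
  n ^ (m + m)       ≡⟨ cong (λ k → n ^ (m + k)) (+-identityʳ m) ⟨
  n ^ (2 * m)       ∎
  where open ≡-Reasoning

∃[k]2^[k*d]≤T<2^[[1+k]*d] : ∀ T d .{{_ : NonZero d}} → 1 ≤ T → ∃[ k ] (2 ^ (k * d) ≤ T × T < 2 ^ (suc k * d))
∃[k]2^[k*d]≤T<2^[[1+k]*d] T d 1≤T =
  let k , fits , ¬fits = ∃-threshold (λ k → 2 ^ (k * d) ≤? T) 1≤T T T<2^[T*d] in k , fits , ≰⇒> ¬fits
  where
  T<2^[T*d] : ¬ 2 ^ (T * d) ≤ T
  T<2^[T*d] le = <⇒≱ (<-≤-trans (n<2^n T) (^-monoʳ-≤ 2 (m≤m*n T d))) le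

-- Finite sums

𝟙 : Bool → ℕ
𝟙 true  = 1
𝟙 false = 0

𝟙-∧ : ∀ b c → 𝟙 (b ∧ c) ≡ 𝟙 b * 𝟙 c
𝟙-∧ true  c = sym (+-identityʳ (𝟙 c))
𝟙-∧ false c = refl

∑-cong : ∀ {n} {f g : Fin n → ℕ} → (∀ i → f i ≡ g i) → sum f ≡ sum g
∑-cong = sum-cong-≗

∑-mono-≤ : ∀ {n} {f g : Fin n → ℕ} → (∀ i → f i ≤ g i) → sum f ≤ sum g
∑-mono-≤ {zero}  f≤g = z≤n
∑-mono-≤ {suc n} {f} {g} f≤g =
  +-mono-≤ (f≤g zero) (∑-mono-≤ {f = λ i → f (suc i)} {g = λ i → g (suc i)} (λ i → f≤g (suc i)))

∑-const : ∀ n c → ∑[ i < n ] c ≡ n * c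
∑-const zero    c = refl
∑-const (suc n) c = cong (c +_) (∑-const n c)

term≤∑ : ∀ {n} (f : Fin n → ℕ) i → f i ≤ sum f
term≤∑ f zero    = m≤m+n (f zero) _
term≤∑ f (suc i) = ≤-trans (term≤∑ (λ j → f (suc j)) i) (m≤n+m _ (f zero))

∃-term-≥-mean : ∀ {n} .{{_ : NonZero n}} (f : Fin n → ℕ) → ∃ λ i → sum f ≤ n * f i
∃-term-≥-mean {suc zero}    f = zero , ≤-refl
∃-term-≥-mean {suc (suc n)} f with ∃-term-≥-mean (λ j → f (suc j))
... | j , ∑tail≤ with f zero ≤? f (suc j)
...   | yes f0≤fj = suc j , +-mono-≤ f0≤fj ∑tail≤
...   | no  f0≰fj = zero , +-monoʳ-≤ (f zero) (≤-trans ∑tail≤ (*-monoʳ-≤ (suc n) (<⇒≤ (≰⇒> f0≰fj))))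

∃-pair-≥-mean : ∀ {n} .{{_ : NonZero n}} (f : Fin n → Fin n → ℕ) →
                ∃[ i ] ∃[ j ] ∑[ k < n ] ∑[ l < n ] f k l ≤ n * n * f i j
∃-pair-≥-mean {n} f with ∃-term-≥-mean (λ i → ∑[ j < n ] f i j)
... | i , ∑∑≤ with ∃-term-≥-mean (f i)
...   | j , ∑≤ = i , j , ≤-trans ∑∑≤ (≤-trans (*-monoʳ-≤ n ∑≤) (≤-reflexive (sym (*-assoc n n (f i j)))))

∑∑-product : ∀ {m n} (f : Fin m → ℕ) (g : Fin n → ℕ) → ∑[ i < m ] ∑[ j < n ] (f i * g j) ≡ sum f * sum g
∑∑-product {m} {n} f g = begin
  ∑[ i < m ] ∑[ j < n ] (f i * g j) ≡⟨ ∑-cong (λ i → *-distribˡ-sum (f i) g) ⟨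
  ∑[ i < m ] (f i * sum g)          ≡⟨ *-distribʳ-sum (sum g) f ⟨
  sum f * sum g                     ∎
  where open ≡-Reasoning

*-distribˡ-∑∑ : ∀ {m n} c (f : Fin m → Fin n → ℕ) → c * ∑[ i < m ] ∑[ j < n ] f i j ≡ ∑[ i < m ] ∑[ j < n ] (c * f i j)
*-distribˡ-∑∑ {m} {n} c f = trans (*-distribˡ-sum c (λ i → ∑[ j < n ] f i j)) (∑-cong (λ i → *-distribˡ-sum c (f i)))

∑∑∑∑-comm : ∀ {k l m n} (f : Fin k → Fin l → Fin m → Fin n → ℕ) →
            ∑[ a < k ] ∑[ b < l ] ∑[ c < m ] ∑[ d < n ] f a b c d ≡ ∑[ c < m ] ∑[ d < n ] ∑[ a < k ] ∑[ b < l ] f a b c d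
∑∑∑∑-comm {k} {l} {m} {n} f =
  trans (∑-cong λ a → ∑-comm λ b c → ∑[ d < n ] f a b c d)
  (trans (∑-cong λ a → ∑-cong λ c → ∑-comm λ b d → f a b c d)
  (trans (∑-comm λ a c → ∑[ d < n ] ∑[ b < l ] f a b c d)
         (∑-cong λ c → ∑-comm λ a d → ∑[ b < l ] f a b c d)))

length-filter-tabulate : ∀ {a p} {A : Set a} {P : Pred A p} (P? : Decidable P) {n} (g : Fin n → A) →
                         length (filter P? (tabulate g)) ≡ ∑[ i < n ] 𝟙 (does (P? (g i)))
length-filter-tabulate P? {zero}  g = refl
length-filter-tabulate P? {suc n} g with does (P? (g zero))
... | true  = cong suc (length-filter-tabulate P? (λ i → g (suc i)))
... | false = length-filter-tabulate P? (λ i → g (suc i))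

-- Sets of ordered pairs and greedy covering

PairSet : ℕ → Set
PairSet n = Fin n → Fin n → Bool

module _ {n : ℕ} where

  ∣_∣ : PairSet n → ℕ
  ∣ U ∣ = ∑[ u < n ] ∑[ w < n ] 𝟙 (U u w)

  _∩_ _─_ : PairSet n → PairSet n → PairSet n
  (U ∩ V) u w = U u w ∧ V u w
  (U ─ V) u w = U u w ∧ not (V u w)

  ∣─∣+∣∩∣≡∣∣ : ∀ U V → ∣ U ─ V ∣ + ∣ U ∩ V ∣ ≡ ∣ U ∣
  ∣─∣+∣∩∣≡∣∣ U V = begin
    ∣ U ─ V ∣ + ∣ U ∩ V ∣                                   ≡⟨ ∑-distrib-+ (λ u → ∑[ w < n ] 𝟙 ((U ─ V) u w)) _ ⟨
    ∑[ u < n ] (∑[ w < n ] 𝟙 ((U ─ V) u w) + ∑[ w < n ] 𝟙 ((U ∩ V) u w))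
                                                            ≡⟨ ∑-cong (λ u → sym (∑-distrib-+ (λ w → 𝟙 ((U ─ V) u w)) _)) ⟩
    ∑[ u < n ] ∑[ w < n ] (𝟙 ((U ─ V) u w) + 𝟙 ((U ∩ V) u w)) ≡⟨ ∑-cong (λ u → ∑-cong (λ w → split (U u w) (V u w))) ⟩
    ∣ U ∣                                                     ∎
    where
    open ≡-Reasoning
    split : ∀ b c → 𝟙 (b ∧ not c) + 𝟙 (b ∧ c) ≡ 𝟙 b
    split true  true  = refl
    split true  false = refl
    split false c     = refl

  ∈⇒∣∣>0 : ∀ U {u w} → U u w ≡ true → 0 < ∣ U ∣
  ∈⇒∣∣>0 U {u} {w} Uuw = begin
    1                       ≡⟨ cong 𝟙 Uuw ⟨
    𝟙 (U u w)               ≤⟨ term≤∑ (λ w → 𝟙 (U u w)) w ⟩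
    ∑[ w < n ] 𝟙 (U u w)    ≤⟨ term≤∑ (λ u → ∑[ w < n ] 𝟙 (U u w)) u ⟩
    ∣ U ∣                   ∎
    where open ≤-Reasoning

  2*∣∣≤n*n : ∀ U → (∀ u w → U u w ≡ true → U w u ≡ false) → 2 * ∣ U ∣ ≤ n * n
  2*∣∣≤n*n U asym = begin
    2 * ∣ U ∣                                           ≡⟨ cong (∣ U ∣ +_) (+-identityʳ ∣ U ∣) ⟩
    ∣ U ∣ + ∣ U ∣                                       ≡⟨ cong (∣ U ∣ +_) (∑-comm (λ u w → 𝟙 (U u w))) ⟩
    ∣ U ∣ + ∑[ u < n ] ∑[ w < n ] 𝟙 (U w u)             ≡⟨ ∑-distrib-+ (λ u → ∑[ w < n ] 𝟙 (U u w)) _ ⟨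
    ∑[ u < n ] (∑[ w < n ] 𝟙 (U u w) + ∑[ w < n ] 𝟙 (U w u))
                                                        ≡⟨ ∑-cong (λ u → sym (∑-distrib-+ (λ w → 𝟙 (U u w)) _)) ⟩
    ∑[ u < n ] ∑[ w < n ] (𝟙 (U u w) + 𝟙 (U w u))       ≤⟨ ∑-mono-≤ (λ u → ∑-mono-≤ (λ w → at-most-one (asym u w))) ⟩
    ∑[ u < n ] ∑[ w < n ] 1                             ≡⟨ ∑-cong {n} {g = λ _ → n * 1} (λ _ → ∑-const n 1) ⟩
    ∑[ u < n ] (n * 1)                                  ≡⟨ ∑-const n (n * 1) ⟩
    n * (n * 1)                                         ≡⟨ cong (n *_) (*-identityʳ n) ⟩
    n * n                                               ∎
    where
    open ≤-Reasoning
    at-most-one : ∀ {b c} → (b ≡ true → c ≡ false) → 𝟙 b + 𝟙 c ≤ 1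
    at-most-one {false} {false} _ = z≤n
    at-most-one {false} {true}  _ = ≤-refl
    at-most-one {true}  {false} _ = ≤-refl
    at-most-one {true}  {true}  b⇒¬c with () ← b⇒¬c refl

  greedy-round : ∀ {a d} U V → d ≤ a → d * ∣ U ∣ ≤ a * ∣ U ∩ V ∣ → a * ∣ U ─ V ∣ ≤ (a ∸ d) * ∣ U ∣
  greedy-round {a} {d} U V d≤a hit = +-cancelʳ-≤ (d * ∣ U ∣) _ _ (begin
    a * ∣ U ─ V ∣ + d * ∣ U ∣              ≤⟨ +-monoʳ-≤ (a * ∣ U ─ V ∣) hit ⟩
    a * ∣ U ─ V ∣ + a * ∣ U ∩ V ∣          ≡⟨ *-distribˡ-+ a ∣ U ─ V ∣ ∣ U ∩ V ∣ ⟨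
    a * (∣ U ─ V ∣ + ∣ U ∩ V ∣)            ≡⟨ cong (a *_) (∣─∣+∣∩∣≡∣∣ U V) ⟩
    a * ∣ U ∣                              ≡⟨ cong (_* ∣ U ∣) (m∸n+n≡m d≤a) ⟨
    (a ∸ d + d) * ∣ U ∣                    ≡⟨ *-distribʳ-+ ∣ U ∣ (a ∸ d) d ⟩
    (a ∸ d) * ∣ U ∣ + d * ∣ U ∣            ∎)
    where open ≤-Reasoning

module GreedyCover {n} {C : Set} (covered-by : C → PairSet n) {a d : ℕ} (d≤a : d ≤ a)
  (choose : PairSet n → C) (choose-hits : ∀ U → d * ∣ U ∣ ≤ a * ∣ U ∩ covered-by (choose U) ∣)
  (U₀ : PairSet n) where

  remaining : ℕ → PairSet n
  choice : ℕ → C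

  remaining zero    = U₀
  remaining (suc k) = remaining k ─ covered-by (choice k)

  choice k = choose (remaining k)

  a^k*∣remaining∣≤ : ∀ k → a ^ k * ∣ remaining k ∣ ≤ (a ∸ d) ^ k * ∣ U₀ ∣
  a^k*∣remaining∣≤ zero    = ≤-refl
  a^k*∣remaining∣≤ (suc k) = begin
    a * a ^ k * ∣ R′ ∣              ≡⟨ xy∙z≈y∙xz a (a ^ k) ∣ R′ ∣ ⟩
    a ^ k * (a * ∣ R′ ∣)            ≤⟨ *-monoʳ-≤ (a ^ k) (greedy-round R (covered-by (choice k)) d≤a (choose-hits R)) ⟩
    a ^ k * ((a ∸ d) * ∣ R ∣)        ≡⟨ x∙yz≈y∙xz (a ^ k) (a ∸ d) ∣ R ∣ ⟩
    (a ∸ d) * (a ^ k * ∣ R ∣)        ≤⟨ *-monoʳ-≤ (a ∸ d) (a^k*∣remaining∣≤ k) ⟩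
    (a ∸ d) * ((a ∸ d) ^ k * ∣ U₀ ∣) ≡⟨ *-assoc (a ∸ d) _ ∣ U₀ ∣ ⟨
    (a ∸ d) * (a ∸ d) ^ k * ∣ U₀ ∣   ∎
    where
    open ≤-Reasoning
    R = remaining k
    R′ = remaining (suc k)

  remaining-or-covered : ∀ k {u w} → U₀ u w ≡ true →
    remaining k u w ≡ true ⊎ ∃[ i ] covered-by (choice (toℕ {k} i)) u w ≡ true
  remaining-or-covered zero    U₀uw = inj₁ U₀uw
  remaining-or-covered (suc k) {u} {w} U₀uw with remaining-or-covered k U₀uw
  ... | inj₂ (i , cov) = inj₂ (inject₁ i , subst (λ j → covered-by (choice j) u w ≡ true) (sym (toℕ-inject₁ i)) cov)
  ... | inj₁ Ruw with covered-by (choice k) u w in cov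
  ...   | true  = inj₂ (fromℕ k , subst (λ j → covered-by (choice j) u w ≡ true) (sym (toℕ-fromℕ k)) cov)
  ...   | false = inj₁ (cong₂ _∧_ Ruw refl)

  covered-after : ∀ k → (a ∸ d) ^ k * ∣ U₀ ∣ < a ^ k → ∀ {u w} → U₀ u w ≡ true →
    ∃[ i ] covered-by (choice (toℕ {k} i)) u w ≡ true
  covered-after k small U₀uw with remaining-or-covered k U₀uw
  ... | inj₂ covered = covered
  ... | inj₁ Ruw = ⊥-elim (<⇒≱ small (begin
    a ^ k                        ≡⟨ *-identityʳ (a ^ k) ⟨
    a ^ k * 1                    ≤⟨ *-monoʳ-≤ (a ^ k) (∈⇒∣∣>0 (remaining k) Ruw) ⟩
    a ^ k * ∣ remaining k ∣       ≤⟨ a^k*∣remaining∣≤ k ⟩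
    (a ∸ d) ^ k * ∣ U₀ ∣          ∎))
    where open ≤-Reasoning

-- Degrees and double counting

module _ {n : ℕ} (G : Graph n) where

  degree≡∑ : ∀ v → degree G v ≡ ∑[ w < n ] 𝟙 (adj G w v)
  degree≡∑ v = trans (length-filter-tabulate (λ w → T? (adj G v w)) (λ w → w))
                     (∑-cong (λ w → cong 𝟙 (Graph.sym G v w)))

  degree<n : ∀ v → degree G v < n
  degree<n v = subst (degree G v <_) (length-tabulate (λ w → w))
    (filter-notAll (λ w → T? (adj G v w)) (allFin n)
      (lose (∈-allFin v) λ vv → subst T (Graph.irrefl G v) vv))

  min-degree⇒p<q : ∀ {p q v} .{{_ : NonZero q}} → p * n ≤ q * degree G v → p < q
  min-degree⇒p<q {p} {q} {v} pn≤qd = *-cancelʳ-< n p q (≤-<-trans pn≤qd (*-monoʳ-< q (degree<n v)))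

  N² : Fin n → Fin n → PairSet n
  N² x y u w = adj G x u ∧ adj G y w

  ∑∑∣∩N²∣≡ : ∀ U → ∑[ x < n ] ∑[ y < n ] ∣ U ∩ N² x y ∣ ≡
                    ∑[ u < n ] ∑[ w < n ] (𝟙 (U u w) * (degree G u * degree G w))
  ∑∑∣∩N²∣≡ U = trans (∑∑∑∑-comm (λ x y u w → 𝟙 ((U ∩ N² x y) u w)))
                     (∑-cong λ u → ∑-cong λ w → pairs-through u w)
    where
    open ≡-Reasoning
    pairs-through : ∀ u w → ∑[ x < n ] ∑[ y < n ] 𝟙 (U u w ∧ (adj G x u ∧ adj G y w)) ≡
                            𝟙 (U u w) * (degree G u * degree G w)
    pairs-through u w = begin
      ∑[ x < n ] ∑[ y < n ] 𝟙 (U u w ∧ (adj G x u ∧ adj G y w))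
        ≡⟨ ∑-cong (λ x → ∑-cong (λ y → trans (𝟙-∧ (U u w) (adj G x u ∧ adj G y w))
                                              (cong (𝟙 (U u w) *_) (𝟙-∧ (adj G x u) (adj G y w))))) ⟩
      ∑[ x < n ] ∑[ y < n ] (𝟙 (U u w) * (𝟙 (adj G x u) * 𝟙 (adj G y w)))
        ≡⟨ *-distribˡ-∑∑ (𝟙 (U u w)) (λ x y → 𝟙 (adj G x u) * 𝟙 (adj G y w)) ⟨
      𝟙 (U u w) * ∑[ x < n ] ∑[ y < n ] (𝟙 (adj G x u) * 𝟙 (adj G y w))
        ≡⟨ cong (𝟙 (U u w) *_) (∑∑-product (λ x → 𝟙 (adj G x u)) (λ y → 𝟙 (adj G y w))) ⟩
      𝟙 (U u w) * (∑[ x < n ] 𝟙 (adj G x u) * ∑[ y < n ] 𝟙 (adj G y w))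
        ≡⟨ cong (𝟙 (U u w) *_) (cong₂ _*_ (degree≡∑ u) (degree≡∑ w)) ⟨
      𝟙 (U u w) * (degree G u * degree G w) ∎

  ∃-dense-N² : ∀ {p q} .{{_ : NonZero n}} → (∀ v → p * n ≤ q * degree G v) →
               ∀ U → ∃[ xy ] p * p * ∣ U ∣ ≤ q * q * ∣ U ∩ uncurry N² xy ∣
  ∃-dense-N² {p} {q} min-degree U with ∃-pair-≥-mean (λ x y → ∣ U ∩ N² x y ∣)
  ... | x , y , ∑∑≤ = (x , y) , *-cancelˡ-≤ (n * n) {{m*n≢0 n n}} (begin
    n * n * (p * p * ∣ U ∣)                                  ≡⟨ *-assoc (n * n) (p * p) ∣ U ∣ ⟨
    n * n * (p * p) * ∣ U ∣                                  ≡⟨ *-distribˡ-∑∑ (n * n * (p * p)) (λ u w → 𝟙 (U u w)) ⟩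
    ∑[ u < n ] ∑[ w < n ] (n * n * (p * p) * 𝟙 (U u w))      ≤⟨ ∑-mono-≤ (λ u → ∑-mono-≤ (λ w → pointwise (U u w) u w)) ⟩
    ∑[ u < n ] ∑[ w < n ] (q * q * (𝟙 (U u w) * (degree G u * degree G w)))
                         ≡⟨ *-distribˡ-∑∑ (q * q) (λ u w → 𝟙 (U u w) * (degree G u * degree G w)) ⟨
    q * q * ∑[ u < n ] ∑[ w < n ] (𝟙 (U u w) * (degree G u * degree G w))
                                                             ≡⟨ cong (q * q *_) (∑∑∣∩N²∣≡ U) ⟨
    q * q * ∑[ x < n ] ∑[ y < n ] ∣ U ∩ N² x y ∣             ≤⟨ *-monoʳ-≤ (q * q) ∑∑≤ ⟩
    q * q * (n * n * ∣ U ∩ N² x y ∣)                          ≡⟨ x∙yz≈y∙xz (q * q) (n * n) _ ⟩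
    n * n * (q * q * ∣ U ∩ N² x y ∣)                          ∎)
    where
    open ≤-Reasoning
    pointwise : ∀ b u w → n * n * (p * p) * 𝟙 b ≤ q * q * (𝟙 b * (degree G u * degree G w))
    pointwise false u w = ≤-trans (≤-reflexive (*-zeroʳ (n * n * (p * p)))) z≤n
    pointwise true  u w = begin
      n * n * (p * p) * 1                          ≡⟨ lhs n p ⟩
      p * n * (p * n)                              ≤⟨ *-mono-≤ (min-degree u) (min-degree w) ⟩
      q * degree G u * (q * degree G w)            ≡⟨ rhs q (degree G u) (degree G w) ⟩
      q * q * (1 * (degree G u * degree G w))      ∎
      where
      lhs : ∀ n p → n * n * (p * p) * 1 ≡ p * n * (p * n)
      lhs = solve-∀
      rhs : ∀ q s t → q * s * (q * t) ≡ q * q * (1 * (s * t))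
      rhs = solve-∀

-- The bridge of two vertices

does≡true⇒ : ∀ {a} {A : Set a} (a? : Dec A) → does a? ≡ true → A
does≡true⇒ (yes a) _ = a

∧≡true⇒ : ∀ {b c} → b ∧ c ≡ true → b ≡ true × c ≡ true
∧≡true⇒ {true} {true} _ = refl , refl

module _ {n : ℕ} (G : Graph n) where

  Adj : Fin n → Fin n → Set
  Adj u v = adj G u v ≡ true

  Adj-sym : ∀ {u v} → Adj u v → Adj v u
  Adj-sym {u} {v} uv = trans (Graph.sym G v u) uv

  Port : Fin n → Fin n → Fin n → Set
  Port x y a = Adj x a × ∃[ w ] (Adj y w × Adj a w)

  Port? : ∀ x y a → Dec (Port x y a)
  Port? x y a = (adj G x a ≟ᵇ true) ×-dec any? (λ w → (adj G y w ≟ᵇ true) ×-dec (adj G a w ≟ᵇ true))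

  -- B(x, y): Link lists each of its edges in one orientation, bridge takes the symmetric closure.
  module Bridge (x y : Fin n) where

    Link : Fin n → Fin n → Set
    Link u v = (Adj x u × Adj y v × Adj u v) ⊎ (u ≡ x × Port x y v) ⊎ (u ≡ y × Port y x v)

    pattern cross xu yv uv = inj₁ (xu , yv , uv)
    pattern spoke-x p      = inj₂ (inj₁ (refl , p))
    pattern spoke-y p      = inj₂ (inj₂ (refl , p))

    Link? : ∀ u v → Dec (Link u v)
    Link? u v = ((adj G x u ≟ᵇ true) ×-dec (adj G y v ≟ᵇ true) ×-dec (adj G u v ≟ᵇ true))
           ⊎-dec (u ≟ᶠ x ×-dec Port? x y v) ⊎-dec (u ≟ᶠ y ×-dec Port? y x v)

    Link⇒Adj : ∀ {u v} → Link u v → Adj u v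
    Link⇒Adj (cross _ _ uv)      = uv
    Link⇒Adj (spoke-x (xv , _))  = xv
    Link⇒Adj (spoke-y (yv , _))  = yv

    bridge : EdgeSubset G
    bridge = record
      { mem    = λ u v → does (Link? u v ⊎-dec Link? v u)
      ; memSym = λ u v → does-⇔ (mk⇔ swap swap) (Link? u v ⊎-dec Link? v u) (Link? v u ⊎-dec Link? u v)
      ; memSub = λ u v uv → [ Link⇒Adj , (λ l → Adj-sym (Link⇒Adj l)) ]′ (does≡true⇒ (Link? u v ⊎-dec Link? v u) uv)
      }

    _⟶_ : Fin n → Fin n → Set
    u ⟶ v = mem bridge u v ≡ true

    forward : ∀ {u v} → Link u v → u ⟶ v
    forward {u} {v} l = dec-true (Link? u v ⊎-dec Link? v u) (inj₁ l)

    backward : ∀ {u v} → Link v u → u ⟶ v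
    backward {u} {v} l = dec-true (Link? u v ⊎-dec Link? v u) (inj₂ l)

    from-x : ∀ {a} → Port x y a → x ⟶ a
    from-x a = forward (spoke-x a)

    to-x : ∀ {a} → Port x y a → a ⟶ x
    to-x a = backward (spoke-x a)

    from-y : ∀ {b} → Port y x b → y ⟶ b
    from-y b = forward (spoke-y b)

    to-y : ∀ {b} → Port y x b → b ⟶ y
    to-y b = backward (spoke-y b)

    ⟶-sym : ∀ {u v} → u ⟶ v → v ⟶ u
    ⟶-sym {u} {v} uv = trans (memSym bridge v u) uv

    across-x : ∀ {a} → Port x y a → ∃[ b ] (Port y x b × a ⟶ b)
    across-x (xa , b , yb , ab) = b , (yb , _ , xa , Adj-sym ab) , forward (cross xa yb ab)

    across-y : ∀ {b} → Port y x b → ∃[ a ] (Port x y a × b ⟶ a)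
    across-y (yb , a , xa , ba) = a , (xa , _ , yb , Adj-sym ba) , backward (cross xa yb (Adj-sym ba))

    data Role : Fin n → Set where
      hub-x  : ∃ (Port x y) → Role x
      port-x : ∀ {v} → Port x y v → Role v
      port-y : ∀ {v} → Port y x v → Role v
      hub-y  : ∃ (Port y x) → Role y

    role : ∀ {v} → Covered bridge v → Role v
    role {v} (w , vw) with does≡true⇒ (Link? v w ⊎-dec Link? w v) vw
    ... | inj₁ (cross xv yw vw′) = port-x (xv , w , yw , vw′)
    ... | inj₁ (spoke-x p)       = hub-x (w , p)
    ... | inj₁ (spoke-y p)       = hub-y (w , p)
    ... | inj₂ (cross xw yv wv)  = port-y (yv , w , xw , Adj-sym wv)
    ... | inj₂ (spoke-x p)       = port-x p
    ... | inj₂ (spoke-y p)       = port-y p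

    private
      D : Fin n → Fin n → Set
      D u v = DistLe bridge u v 3

      path₀ : ∀ {u} → D u u
      path₀ = 0 , z≤n , here

      path₁ : ∀ {u v} → u ⟶ v → D u v
      path₁ e = 1 , s≤s z≤n , step e here

      path₂ : ∀ {u v w} → u ⟶ v → v ⟶ w → D u w
      path₂ e f = 2 , s≤s (s≤s z≤n) , step e (step f here)

      path₃ : ∀ {u v w z} → u ⟶ v → v ⟶ w → w ⟶ z → D u z
      path₃ e f g = 3 , s≤s (s≤s (s≤s z≤n)) , step e (step f (step g here))

    distance : ∀ {u v} → Role u → Role v → D u v
    distance (hub-x _)        (hub-x _)  = path₀
    distance (hub-x _)        (port-x a) = path₁ (from-x a)
    distance (hub-x _)        (port-y b) with _ , a′ , ba′ ← across-y b = path₂ (from-x a′) (⟶-sym ba′)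
    distance (hub-x (_ , a))  (hub-y _)  with _ , b′ , ab′ ← across-x a = path₃ (from-x a) ab′ (to-y b′)
    distance (port-x a)       (hub-x _)  = path₁ (to-x a)
    distance (port-x a)       (port-x a′) = path₂ (to-x a) (from-x a′)
    distance (port-x a)       (port-y b) with _ , b′ , ab′ ← across-x a = path₃ ab′ (to-y b′) (from-y b)
    distance (port-x a)       (hub-y _)  with _ , b′ , ab′ ← across-x a = path₂ ab′ (to-y b′)
    distance (port-y b)       (hub-x _)  with _ , a′ , ba′ ← across-y b = path₂ ba′ (to-x a′)
    distance (port-y b)       (port-x a) with _ , a′ , ba′ ← across-y b = path₃ ba′ (to-x a′) (from-x a)
    distance (port-y b)       (port-y b′) = path₂ (to-y b) (from-y b′)
    distance (port-y b)       (hub-y _)  = path₁ (to-y b)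
    distance (hub-y (_ , b))  (hub-x _)  with _ , a′ , ba′ ← across-y b = path₃ (from-y b) ba′ (to-x a′)
    distance (hub-y _)        (port-x a) with _ , b′ , ab′ ← across-x a = path₂ (from-y b′) (⟶-sym ab′)
    distance (hub-y _)        (port-y b) = path₁ (from-y b)
    distance (hub-y _)        (hub-y _)  = path₀

    bridge-diameter≤3 : DiamLe bridge 3
    bridge-diameter≤3 u v cu cv = distance (role cu) (role cv)

    bridge-⊇-N²-edges : ∀ {u v} → Adj x u → Adj y v → Adj u v → mem bridge u v ≡ true
    bridge-⊇-N²-edges xu yv uv = forward (cross xu yv uv)

-- Covering the edges

module _ {n : ℕ} (G : Graph n) where

  oriented : PairSet n
  oriented u w = does (u <ᶠ? w) ∧ adj G u w

  oriented-asym : ∀ u w → oriented u w ≡ true → oriented w u ≡ false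
  oriented-asym u w uw =
    cong (_∧ adj G w u) (dec-false (w <ᶠ? u) (<ᶠ-asym (does≡true⇒ (u <ᶠ? w) (proj₁ (∧≡true⇒ uw)))))

  module _ {ℓ} (c : Fin ℓ → Fin n × Fin n)
           (covers : ∀ {u w} → oriented u w ≡ true → ∃[ i ] uncurry (N² G) (c i) u w ≡ true) where

    oriented⇒in-bridge : ∀ {u v} → oriented u v ≡ true → ∃[ i ] mem (uncurry (Bridge.bridge G) (c i)) u v ≡ true
    oriented⇒in-bridge uv with i , xu∧yv ← covers uv with xu , yv ← ∧≡true⇒ xu∧yv =
      i , Bridge.bridge-⊇-N²-edges G _ _ xu yv (proj₂ (∧≡true⇒ uv))

    bridges-cover : ∀ u v → adj G u v ≡ true → ∃[ i ] mem (uncurry (Bridge.bridge G) (c i)) u v ≡ true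
    bridges-cover u v uv with <ᶠ-cmp u v
    ... | tri< u<v _ _ = oriented⇒in-bridge (cong₂ _∧_ (dec-true (u <ᶠ? v) u<v) uv)
    ... | tri> _ _ v<u with i , vu ← oriented⇒in-bridge (cong₂ _∧_ (dec-true (v <ᶠ? u) v<u) (Adj-sym G uv)) =
      i , trans (memSym (uncurry (Bridge.bridge G) (c i)) u v) vu
    ... | tri≈ _ refl _ with () ← trans (sym uv) (Graph.irrefl G u)

theorem3p1 : (n p q : ℕ) → 1 ≤ n → 1 ≤ p → 1 ≤ q → (G : Graph n) →
    (∀ v → p * n ≤ q * degree G v) →
    ∃[ ℓ ] Σ (Fin ℓ → EdgeSubset G) λ E →
      (2 ^ (ℓ * p * p) ≤ n ^ (2 * q * q)) ×
      (∀ u v → adj G u v ≡ true → ∃[ i ] mem (E i) u v ≡ true) ×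
      (∀ i → DiamLe (E i) 3)
theorem3p1 n@(suc _) p@(suc _) q@(suc _) _ _ _ G min-degree
  with k , fits , overflows ← ∃[k]2^[k*d]≤T<2^[[1+k]*d] ((n * n) ^ (q * q)) (p * p) (m^n>0 (n * n) (q * q)) =
  k , (λ i → uncurry (Bridge.bridge G) (choice (toℕ i))) , ℓ-bound ,
  bridges-cover G (λ i → choice (toℕ i)) (covered-after k few-left) ,
  λ i → Bridge.bridge-diameter≤3 G _ _
  where
  p<q : p < q
  p<q = min-degree⇒p<q G (min-degree zero)
  d<a : p * p < q * q
  d<a = *-mono-< p<q p<q
  densest = ∃-dense-N² G {p} {q} min-degree
  open GreedyCover {n} (uncurry (N² G)) {q * q} {p * p} (<⇒≤ d<a) (λ U → proj₁ (densest U)) (λ U → proj₂ (densest U))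
                   (oriented G)
  few-left : (q * q ∸ p * p) ^ k * ∣ oriented G ∣ < (q * q) ^ k
  few-left = [a∸d]^k*M<a^k {k = k} d<a (2*∣∣≤n*n (oriented G) (oriented-asym G)) overflows
  ℓ-bound : 2 ^ (k * p * p) ≤ n ^ (2 * q * q)
  ℓ-bound = subst₂ _≤_ (cong (2 ^_) (sym (*-assoc k p p)))
                       (trans ([n*n]^m≡n^[2*m] n (q * q)) (cong (n ^_) (sym (*-assoc 2 q q)))) fits
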